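{- Let $A$ be an h-lattice. Then $A$ is a semi-Heyting algebra if and only if $\mathrm{K}(A)$ is a semi-Nelson algebra.
   Context: An h-lattice is an algebra $\langle A,\wedge,\vee,\rightarrow,0,1\rangle$ of type $(2,2,2,0,0)$ such that $\langle A,\wedge,\vee,0,1\rangle$ is a bounded distributive lattice, $a\rightarrow a=1$ and $a\wedge(a\rightarrow b)\le b$ for all $a,b$. For an h-lattice $A$, $\mathrm{K}(A)=\{(a,b)\in A\times A: a\wedge b=0\}$ with operations $(a,b)\wedge(c,d)=(a\wedge c,b\vee d)$, $(a,b)\vee(c,d)=(a\vee c,b\wedge d)$, $\sim(a,b)=(b,a)$, $(a,b)\rightarrow(c,d)=(a\rightarrow c,a\wedge d)$, constants $0=(0,1)$, $1=(1,0)$. A semi-Heyting algebra is an algebra $\langle H,\wedge,\vee,\rightarrow,0,1\rangle$ such that $\langle H,\wedge,\vee,0,1\rangle$ is a bounded lattice and for all $a,b,d$: $a\wedge(a\rightarrow b)=a\wedge b$; $a\wedge(b\rightarrow d)=a\wedge[(a\wedge b)\rightarrow(a\wedge d)]$; $a\rightarrow a=1$. Write $x\rightarrow_N y$ for $x\rightarrow(x\wedge y)$. A semi-Nelson algebra is an algebra $\langle T,\wedge,\vee,\rightarrow,\sim,1\rangle$ (here considered with $0=\sim1$) such that for all $x,y,z$: (SN1) $x\wedge(x\vee y)=x$; (SN2) $x\wedge(y\vee z)=(z\wedge x)\vee(y\wedge x)$; (SN3) $\sim\sim x=x$; (SN4) $\sim(x\wedge y)=\sim x\vee\sim y$; (SN5)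 $x\wedge\sim x=(x\wedge\sim x)\wedge(y\vee\sim y)$; (SN6) $x\wedge(x\rightarrow_N y)=x\wedge(\sim x\vee y)$; (SN7) $x\rightarrow_N(y\rightarrow_N z)=(x\wedge y)\rightarrow_N z$; (SN8) $(x\rightarrow_N y)\rightarrow_N[(y\rightarrow_N x)\rightarrow_N[(x\rightarrow z)\rightarrow_N(y\rightarrow z)]]=1$; (SN9) $(x\rightarrow_N y)\rightarrow_N[(y\rightarrow_N x)\rightarrow_N[(z\rightarrow x)\rightarrow_N(z\rightarrow y)]]=1$; (SN10) $\sim(x\rightarrow y)\rightarrow_N(x\wedge\sim y)=1$; (SN11) $(x\wedge\sim y)\rightarrow_N\sim(x\rightarrow y)=1$. -}

module Defs where

open import Level using (Level; _⊔_; suc)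
open import Data.Product using (Σ; _,_; proj₁; proj₂; _×_)
open import Relation.Binary.PropositionalEquality
open import Algebra.Lattice.Structures using (IsDistributiveLattice)

record HLattice (ℓ : Level) : Set (suc ℓ) where
  infixr 7 _∧_
  infixr 6 _∨_
  infixr 5 _⇒_
  infix 4 _≤_
  field
    Carrier : Set ℓ
    _∧_ _∨_ _⇒_ : Carrier → Carrier → Carrier
    𝟘 𝟙 : Carrier
  _≤_ : Carrier → Carrier → Set ℓ
  a ≤ b = a ∧ b ≡ a
  field
    isDistributiveLattice : IsDistributiveLattice _≡_ _∨_ _∧_
    𝟘-least    : ∀ a → 𝟘 ≤ a
    𝟙-greatest : ∀ a → a ≤ 𝟙
    ⇒-refl     : ∀ a → a ⇒ a ≡ 𝟙
    mp         : ∀ a b → (a ∧ (a ⇒ b)) ≤ b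
  open IsDistributiveLattice isDistributiveLattice public
    hiding (refl; sym; trans; reflexive; isEquivalence; isPartialEquivalence)

-- A (an h-lattice, whose reduct is already a bounded distributive lattice)
-- is a semi-Heyting algebra.
record IsSemiHeyting {ℓ} (A : HLattice ℓ) : Set ℓ where
  open HLattice A
  field
    sh1 : ∀ a b → a ∧ (a ⇒ b) ≡ a ∧ b
    sh2 : ∀ a b d → a ∧ (b ⇒ d) ≡ a ∧ ((a ∧ b) ⇒ (a ∧ d))
    sh3 : ∀ a → a ⇒ a ≡ 𝟙

record SNAlgebra (c ℓ : Level) : Set (suc (c ⊔ ℓ)) where
  field
    Carrier : Set c
    _≈_ : Carrier → Carrier → Set ℓ
    _∧_ _∨_ _⇒_ : Carrier → Carrier → Carrier
    ∼_ : Carrier → Carrier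
    𝟙 : Carrier

record IsSemiNelson {c ℓ} (T : SNAlgebra c ℓ) : Set (c ⊔ ℓ) where
  open SNAlgebra T
  _⇒N_ : Carrier → Carrier → Carrier
  x ⇒N y = x ⇒ (x ∧ y)
  field
    SN1  : ∀ x y → (x ∧ (x ∨ y)) ≈ x
    SN2  : ∀ x y z → (x ∧ (y ∨ z)) ≈ ((z ∧ x) ∨ (y ∧ x))
    SN3  : ∀ x → (∼ (∼ x)) ≈ x
    SN4  : ∀ x y → (∼ (x ∧ y)) ≈ ((∼ x) ∨ (∼ y))
    SN5  : ∀ x y → (x ∧ (∼ x)) ≈ ((x ∧ (∼ x)) ∧ (y ∨ (∼ y)))
    SN6  : ∀ x y → (x ∧ (x ⇒N y)) ≈ (x ∧ ((∼ x) ∨ y))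
    SN7  : ∀ x y z → (x ⇒N (y ⇒N z)) ≈ ((x ∧ y) ⇒N z)
    SN8  : ∀ x y z →
      ((x ⇒N y) ⇒N ((y ⇒N x) ⇒N ((x ⇒ z) ⇒N (y ⇒ z)))) ≈ 𝟙
    SN9  : ∀ x y z →
      ((x ⇒N y) ⇒N ((y ⇒N x) ⇒N ((z ⇒ x) ⇒N (z ⇒ y)))) ≈ 𝟙
    SN10 : ∀ x y → ((∼ (x ⇒ y)) ⇒N (x ∧ (∼ y))) ≈ 𝟙
    SN11 : ∀ x y → ((x ∧ (∼ y)) ⇒N (∼ (x ⇒ y))) ≈ 𝟙

-- The algebra K(A) = {(a,b) ∈ A × A : a ∧ b = 0}; two elements are equal
-- iff their underlying pairs are equal.
module KConstruction {ℓ} (A : HLattice ℓ) where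
  open HLattice A
  open ≡-Reasoning

  KCarrier : Set ℓ
  KCarrier = Σ (Carrier × Carrier) (λ p → proj₁ p ∧ proj₂ p ≡ 𝟘)

  fst snd : KCarrier → Carrier
  fst ((a , _) , _) = a
  snd ((_ , b) , _) = b

  ∧𝟘 : ∀ x → x ∧ 𝟘 ≡ 𝟘
  ∧𝟘 x = trans (∧-comm x 𝟘) (𝟘-least x)

  meet-closed : ∀ a b c d → a ∧ b ≡ 𝟘 → c ∧ d ≡ 𝟘 → (a ∧ c) ∧ (b ∨ d) ≡ 𝟘
  meet-closed a b c d ab cd = begin
    (a ∧ c) ∧ (b ∨ d)                 ≡⟨ ∧-distribˡ-∨ (a ∧ c) b d ⟩
    ((a ∧ c) ∧ b) ∨ ((a ∧ c) ∧ d)     ≡⟨ cong₂ _∨_ e1 e2 ⟩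
    𝟘 ∨ 𝟘                             ≡⟨ trans (cong (𝟘 ∨_) (sym (𝟘-least 𝟘))) (∨-absorbs-∧ 𝟘 𝟘) ⟩
    𝟘 ∎
    where
    e1 : (a ∧ c) ∧ b ≡ 𝟘
    e1 = begin
      (a ∧ c) ∧ b   ≡⟨ ∧-assoc a c b ⟩
      a ∧ (c ∧ b)   ≡⟨ cong (a ∧_) (∧-comm c b) ⟩
      a ∧ (b ∧ c)   ≡⟨ sym (∧-assoc a b c) ⟩
      (a ∧ b) ∧ c   ≡⟨ cong (_∧ c) ab ⟩
      𝟘 ∧ c         ≡⟨ 𝟘-least c ⟩
      𝟘 ∎
    e2 : (a ∧ c) ∧ d ≡ 𝟘
    e2 = begin
      (a ∧ c) ∧ d   ≡⟨ ∧-assoc a c d ⟩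
      a ∧ (c ∧ d)   ≡⟨ cong (a ∧_) cd ⟩
      a ∧ 𝟘         ≡⟨ ∧𝟘 a ⟩
      𝟘 ∎

  join-closed : ∀ a b c d → a ∧ b ≡ 𝟘 → c ∧ d ≡ 𝟘 → (a ∨ c) ∧ (b ∧ d) ≡ 𝟘
  join-closed a b c d ab cd = begin
    (a ∨ c) ∧ (b ∧ d)   ≡⟨ ∧-comm (a ∨ c) (b ∧ d) ⟩
    (b ∧ d) ∧ (a ∨ c)   ≡⟨ meet-closed b a d c (trans (∧-comm b a) ab) (trans (∧-comm d c) cd) ⟩
    𝟘 ∎

  imp-closed : ∀ a c d → c ∧ d ≡ 𝟘 → (a ⇒ c) ∧ (a ∧ d) ≡ 𝟘
  imp-closed a c d cd = begin
    (a ⇒ c) ∧ (a ∧ d)         ≡⟨ sym (∧-assoc (a ⇒ c) a d) ⟩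
    ((a ⇒ c) ∧ a) ∧ d         ≡⟨ cong (_∧ d) (∧-comm (a ⇒ c) a) ⟩
    (a ∧ (a ⇒ c)) ∧ d         ≡⟨ cong (_∧ d) (sym (mp a c)) ⟩
    ((a ∧ (a ⇒ c)) ∧ c) ∧ d   ≡⟨ ∧-assoc (a ∧ (a ⇒ c)) c d ⟩
    (a ∧ (a ⇒ c)) ∧ (c ∧ d)   ≡⟨ cong ((a ∧ (a ⇒ c)) ∧_) cd ⟩
    (a ∧ (a ⇒ c)) ∧ 𝟘         ≡⟨ ∧𝟘 (a ∧ (a ⇒ c)) ⟩
    𝟘 ∎

  K : SNAlgebra ℓ ℓ
  K = record
    { Carrier = KCarrier
    ; _≈_ = λ x y → proj₁ x ≡ proj₁ y
    ; _∧_ = λ { ((a , b) , p) ((c , d) , q) → ((a ∧ c) , (b ∨ d)) , meet-closed a b c d p q }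
    ; _∨_ = λ { ((a , b) , p) ((c , d) , q) → ((a ∨ c) , (b ∧ d)) , join-closed a b c d p q }
    ; _⇒_ = λ { ((a , b) , p) ((c , d) , q) → ((a ⇒ c) , (a ∧ d)) , imp-closed a c d q }
    ; ∼_ = λ { ((a , b) , p) → (b , a) , trans (∧-comm b a) p }
    ; 𝟙 = (𝟙 , 𝟘) , ∧𝟘 𝟙
    }

K : ∀ {ℓ} → HLattice ℓ → SNAlgebra ℓ ℓ
K A = KConstruction.K A

{-# OPTIONS --safe #-}
module Submission where

-- Write a ⇒N b = a ⇒ (a ∧ b).  Axiom (SH2) says precisely that ⇒ is compatible in
-- each argument: t ∧ a = t ∧ c implies t ∧ (a ⇒ e) = t ∧ (c ⇒ e) and
-- t ∧ (e ⇒ a) = t ∧ (e ⇒ c).  Together with a ⇒ a = 1 this makes ⇒N a Heyting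
-- implication, from which (SH1) follows.  In K(A) the first component of x ⇒N y is
-- fst x ⇒N fst y, and second components are settled by disjointness
-- (a ∧ b = 0 gives a ∧ (b ∨ c) = a ∧ c); in particular x ⇒N y = 1 just says
-- fst x ≤ fst y.  So (SN1)-(SN5), (SN10) and (SN11) hold in K(A) for every h-lattice,
-- while (SN6)-(SN9) come down to a ∧ (a ⇒N b) = a ∧ b, currying for ⇒N, and
-- compatibility of ⇒ written internally as (a ⇒N c) ∧ (c ⇒N a) ∧ (a ⇒ e) ≤ c ⇒ e.
-- Conversely, evaluating (SN7)-(SN9) at the elements (a , 0) gives back currying,
-- hence residuation, and compatibility, hence (SH1) and (SH2).

open import Level using (Level)
open import Function.Bundles using (_⇔_; mk⇔)
open import Data.Product using (_,_; proj₁)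
open import Relation.Binary.PropositionalEquality
  using (_≡_; refl; sym; trans; cong; cong₂; subst; module ≡-Reasoning)
open import Algebra.Lattice.Bundles using (Lattice)
import Algebra.Lattice.Properties.Lattice as LatticeProperties
import Relation.Binary.Lattice as Order
open import Relation.Binary.Lattice.Structures using (IsBoundedLattice)
import Relation.Binary.Lattice.Properties.MeetSemilattice as MeetSemilatticeProperties
import Relation.Binary.Lattice.Properties.BoundedJoinSemilattice as BoundedJoinProperties
import Relation.Binary.Lattice.Properties.HeytingAlgebra as HeytingAlgebraProperties
import Relation.Binary.Reasoning.PartialOrder as ≤-Reasoning
open import Defs

module HLatticeProperties {ℓ : Level} (A : HLattice ℓ) where
  open HLattice A hiding (_≤_)

  lattice : Lattice ℓ ℓ
  lattice = record { isLattice = isLattice }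

  orderLattice : Order.Lattice ℓ ℓ ℓ
  orderLattice = LatticeProperties.∨-∧-orderTheoreticLattice lattice

  -- The order of the library, x ≤ y = (x ≡ x ∧ y), is HLattice's _≤_ read backwards.
  open Order.Lattice orderLattice
    using (_≤_; poset; meetSemilattice; x∧y≤x; x∧y≤y; ∧-greatest)
    renaming (refl to ≤-refl; trans to ≤-trans; antisym to ≤-antisym; reflexive to ≤-reflexive)
    public
  open MeetSemilatticeProperties meetSemilattice using (∧-monotonic; ∧-idempotent) public

  ⇒-mp : ∀ a b → a ∧ (a ⇒ b) ≤ b
  ⇒-mp a b = sym (mp a b)

  𝟘-min : ∀ a → 𝟘 ≤ a
  𝟘-min a = sym (𝟘-least a)

  𝟙-max : ∀ a → a ≤ 𝟙
  𝟙-max a = sym (𝟙-greatest a)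

  isBoundedLattice : IsBoundedLattice _≡_ _≤_ _∨_ _∧_ 𝟙 𝟘
  isBoundedLattice = record
    { isLattice = Order.Lattice.isLattice orderLattice
    ; maximum   = 𝟙-max
    ; minimum   = 𝟘-min
    }

  boundedLattice : Order.BoundedLattice ℓ ℓ ℓ
  boundedLattice = record { isBoundedLattice = isBoundedLattice }

  open BoundedJoinProperties (Order.BoundedLattice.boundedJoinSemilattice boundedLattice)
    using () renaming (identityˡ to ∨-identityˡ; identityʳ to ∨-identityʳ) public

  ≤𝟘⇒≡𝟘 : ∀ {a} → a ≤ 𝟘 → a ≡ 𝟘
  ≤𝟘⇒≡𝟘 {a} a≤𝟘 = ≤-antisym a≤𝟘 (𝟘-min a)

  ∧-disjoint-∨ : ∀ {a b} c → a ∧ b ≡ 𝟘 → a ∧ (b ∨ c) ≡ a ∧ c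
  ∧-disjoint-∨ {a} {b} c a∧b≡𝟘 = begin
    a ∧ (b ∨ c)        ≡⟨ ∧-distribˡ-∨ a b c ⟩
    (a ∧ b) ∨ (a ∧ c)  ≡⟨ cong (_∨ (a ∧ c)) a∧b≡𝟘 ⟩
    𝟘 ∨ (a ∧ c)        ≡⟨ ∨-identityˡ (a ∧ c) ⟩
    a ∧ c              ∎
    where open ≡-Reasoning

  x∧y≡x∧[x∧y] : ∀ x y → x ∧ y ≡ x ∧ (x ∧ y)
  x∧y≡x∧[x∧y] x y = trans (cong (_∧ y) (sym (∧-idempotent x))) (∧-assoc x x y)

  ∧-equalise : ∀ {x a c} → x ∧ a ≤ c → x ∧ c ≤ a → x ∧ a ≡ x ∧ c
  ∧-equalise {x} x∧a≤c x∧c≤a =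
    ≤-antisym (∧-greatest (x∧y≤x x _) x∧a≤c) (∧-greatest (x∧y≤x x _) x∧c≤a)

  infixr 5 _⇒N_
  _⇒N_ : Carrier → Carrier → Carrier
  a ⇒N b = a ⇒ (a ∧ b)

  ⇒N-transpose-∧ : ∀ {x a b} → x ≤ a ⇒N b → x ∧ a ≤ b
  ⇒N-transpose-∧ {x} {a} {b} x≤a⇒Nb = begin
    x ∧ a         ≤⟨ ∧-monotonic x≤a⇒Nb ≤-refl ⟩
    (a ⇒N b) ∧ a  ≡⟨ ∧-comm (a ⇒N b) a ⟩
    a ∧ (a ⇒N b)  ≤⟨ ⇒-mp a (a ∧ b) ⟩
    a ∧ b         ≤⟨ x∧y≤y a b ⟩
    b             ∎
    where open ≤-Reasoning poset

  ≤⇒⇒N≡𝟙 : ∀ {a b} → a ≤ b → a ⇒N b ≡ 𝟙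
  ≤⇒⇒N≡𝟙 {a} a≤b = trans (cong (a ⇒_) (sym a≤b)) (⇒-refl a)

  ⇒N≡𝟙⇒≤ : ∀ {a b} → a ⇒N b ≡ 𝟙 → a ≤ b
  ⇒N≡𝟙⇒≤ {a} {b} a⇒Nb≡𝟙 = begin
    a      ≡⟨ ∧-idempotent a ⟨
    a ∧ a  ≤⟨ ⇒N-transpose-∧ (subst (a ≤_) (sym a⇒Nb≡𝟙) (𝟙-max a)) ⟩
    b      ∎
    where open ≤-Reasoning poset

  ⇒N-agree : ∀ a c → ((a ⇒N c) ∧ (c ⇒N a)) ∧ a ≡ ((a ⇒N c) ∧ (c ⇒N a)) ∧ c
  ⇒N-agree a c = ∧-equalise (⇒N-transpose-∧ (x∧y≤x _ _)) (⇒N-transpose-∧ (x∧y≤y _ _))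

  Residuated : Set ℓ
  Residuated = ∀ {x a b} → x ∧ a ≤ b → x ≤ a ⇒N b

  Compatible : (Carrier → Carrier) → Set ℓ
  Compatible f = ∀ {t a c} → t ∧ a ≡ t ∧ c → t ∧ f a ≡ t ∧ f c

  currying⇒residuated : (∀ a b c → a ⇒N (b ⇒N c) ≡ (a ∧ b) ⇒N c) → Residuated
  currying⇒residuated curry {x} {a} {b} x∧a≤b = ⇒N≡𝟙⇒≤ (begin
    x ⇒N (a ⇒N b)  ≡⟨ curry x a b ⟩
    (x ∧ a) ⇒N b   ≡⟨ ≤⇒⇒N≡𝟙 x∧a≤b ⟩
    𝟙              ∎)
    where open ≡-Reasoning

  compatibleʳ⇒residuated : (∀ e → Compatible (e ⇒_)) → Residuated
  compatibleʳ⇒residuated compatibleʳ {x} {a} {b} x∧a≤b = begin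
    x                ≡⟨ 𝟙-max x ⟩
    x ∧ 𝟙            ≡⟨ cong (x ∧_) (⇒-refl a) ⟨
    x ∧ (a ⇒ a)      ≡⟨ compatibleʳ a (trans x∧a≤b (∧-assoc x a b)) ⟩
    x ∧ (a ⇒N b)     ∎
    where open ≡-Reasoning

  module _ (residuated : Residuated) where

    heytingAlgebra : Order.HeytingAlgebra ℓ ℓ ℓ
    heytingAlgebra = record
      { isHeytingAlgebra = record
        { isBoundedLattice = isBoundedLattice
        ; exponential      = λ _ _ _ → residuated , ⇒N-transpose-∧
        }
      }

    open HeytingAlgebraProperties heytingAlgebra using (⇨-app; ⇨-curry)

    ∧-⇒N : ∀ a b → a ∧ (a ⇒N b) ≡ a ∧ b
    ∧-⇒N a b = trans (∧-comm a (a ⇒N b)) (trans ⇨-app (∧-comm b a))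

    ⇒N-curry : ∀ a b c → a ⇒N (b ⇒N c) ≡ (a ∧ b) ⇒N c
    ⇒N-curry a b c = sym ⇨-curry

    compatible⇒⇒N-≤ : ∀ {f} → Compatible f → ∀ a c → a ⇒N c ≤ (c ⇒N a) ⇒N (f a ⇒N f c)
    compatible⇒⇒N-≤ {f} compatible a c = residuated (residuated (begin
      ((a ⇒N c) ∧ (c ⇒N a)) ∧ f a  ≡⟨ compatible (⇒N-agree a c) ⟩
      ((a ⇒N c) ∧ (c ⇒N a)) ∧ f c  ≤⟨ x∧y≤y _ (f c) ⟩
      f c                          ∎))
      where open ≤-Reasoning poset

    ⇒N-≤⇒compatible : ∀ {f} → (∀ a c → a ⇒N c ≤ (c ⇒N a) ⇒N (f a ⇒N f c)) → Compatible f
    ⇒N-≤⇒compatible {f} ⇒N-≤ {t} t∧a≡t∧c =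
      ∧-equalise (below t∧a≡t∧c) (below (sym t∧a≡t∧c))
      where
      open ≤-Reasoning poset

      t∧a≡t∧c⇒t∧a≤c : ∀ {a c} → t ∧ a ≡ t ∧ c → t ∧ a ≤ c
      t∧a≡t∧c⇒t∧a≤c {c = c} t∧a≡t∧c = ≤-trans (≤-reflexive t∧a≡t∧c) (x∧y≤y t c)

      below : ∀ {a c} → t ∧ a ≡ t ∧ c → t ∧ f a ≤ f c
      below {a} {c} t∧a≡t∧c = begin
        t ∧ f a
          ≤⟨ ∧-monotonic (∧-greatest (residuated (t∧a≡t∧c⇒t∧a≤c t∧a≡t∧c))
                                     (residuated (t∧a≡t∧c⇒t∧a≤c (sym t∧a≡t∧c)))) ≤-refl ⟩
        ((a ⇒N c) ∧ (c ⇒N a)) ∧ f a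
          ≤⟨ ⇒N-transpose-∧ (⇒N-transpose-∧ (⇒N-≤ a c)) ⟩
        f c ∎

  module _ (semiHeyting : IsSemiHeyting A) where
    open IsSemiHeyting semiHeyting

    semiHeyting⇒compatibleˡ : ∀ e → Compatible (_⇒ e)
    semiHeyting⇒compatibleˡ e {t} {a} {c} t∧a≡t∧c = begin
      t ∧ (a ⇒ e)              ≡⟨ sh2 t a e ⟩
      t ∧ ((t ∧ a) ⇒ (t ∧ e))  ≡⟨ cong (λ u → t ∧ (u ⇒ (t ∧ e))) t∧a≡t∧c ⟩
      t ∧ ((t ∧ c) ⇒ (t ∧ e))  ≡⟨ sh2 t c e ⟨
      t ∧ (c ⇒ e)              ∎
      where open ≡-Reasoning

    semiHeyting⇒compatibleʳ : ∀ e → Compatible (e ⇒_)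
    semiHeyting⇒compatibleʳ e {t} {a} {c} t∧a≡t∧c = begin
      t ∧ (e ⇒ a)              ≡⟨ sh2 t e a ⟩
      t ∧ ((t ∧ e) ⇒ (t ∧ a))  ≡⟨ cong (λ u → t ∧ ((t ∧ e) ⇒ u)) t∧a≡t∧c ⟩
      t ∧ ((t ∧ e) ⇒ (t ∧ c))  ≡⟨ sh2 t e c ⟨
      t ∧ (e ⇒ c)              ∎
      where open ≡-Reasoning

  compatible⇒semiHeyting : (∀ e → Compatible (_⇒ e)) → (∀ e → Compatible (e ⇒_)) →
                           IsSemiHeyting A
  compatible⇒semiHeyting compatibleˡ compatibleʳ = record
    { sh1 = λ a b → trans (compatibleʳ a (x∧y≡x∧[x∧y] a b))
                          (∧-⇒N (compatibleʳ⇒residuated compatibleʳ) a b)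
    ; sh2 = λ a b d → trans (compatibleˡ d (x∧y≡x∧[x∧y] a b))
                            (compatibleʳ (a ∧ b) (x∧y≡x∧[x∧y] a d))
    ; sh3 = ⇒-refl
    }

module KProperties {ℓ : Level} (A : HLattice ℓ) where
  open HLattice A hiding (_≤_)
  open HLatticeProperties A
  open KConstruction A using (KCarrier; fst; ∧𝟘; meet-closed)
  open SNAlgebra (K A) using () renaming
    (_≈_ to _≈ᴷ_; _∧_ to _∧ᴷ_; _∨_ to _∨ᴷ_; _⇒_ to _⇒ᴷ_; ∼_ to ∼ᴷ_; 𝟙 to 𝟙ᴷ)

  infixr 5 _⇒Nᴷ_
  _⇒Nᴷ_ : KCarrier → KCarrier → KCarrier
  x ⇒Nᴷ y = x ⇒ᴷ (x ∧ᴷ y)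

  ⇒Nᴷ≈𝟙ᴷ : ∀ x y → fst x ≤ fst y → (x ⇒Nᴷ y) ≈ᴷ 𝟙ᴷ
  ⇒Nᴷ≈𝟙ᴷ ((a , b) , a∧b≡𝟘) ((c , d) , c∧d≡𝟘) a≤c = cong₂ _,_ (≤⇒⇒N≡𝟙 a≤c) (begin
    a ∧ (b ∨ d)  ≡⟨ ∧-disjoint-∨ d a∧b≡𝟘 ⟩
    a ∧ d        ≡⟨ ≤𝟘⇒≡𝟘 (≤-trans (∧-monotonic a≤c ≤-refl) (≤-reflexive c∧d≡𝟘)) ⟩
    𝟘            ∎)
    where open ≡-Reasoning

  K-∧-absorbs-∨ : ∀ x y → (x ∧ᴷ (x ∨ᴷ y)) ≈ᴷ x
  K-∧-absorbs-∨ ((a , b) , _) ((c , d) , _) = cong₂ _,_ (∧-absorbs-∨ a c) (∨-absorbs-∧ b d)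

  K-∧-distrib-∨ : ∀ x y z → (x ∧ᴷ (y ∨ᴷ z)) ≈ᴷ ((z ∧ᴷ x) ∨ᴷ (y ∧ᴷ x))
  K-∧-distrib-∨ ((a , b) , _) ((c , d) , _) ((e , f) , _) = cong₂ _,_
    (begin
      a ∧ (c ∨ e)        ≡⟨ ∧-comm a (c ∨ e) ⟩
      (c ∨ e) ∧ a        ≡⟨ ∧-distribʳ-∨ a c e ⟩
      (c ∧ a) ∨ (e ∧ a)  ≡⟨ ∨-comm (c ∧ a) (e ∧ a) ⟩
      (e ∧ a) ∨ (c ∧ a)  ∎)
    (begin
      b ∨ (d ∧ f)        ≡⟨ ∨-comm b (d ∧ f) ⟩
      (d ∧ f) ∨ b        ≡⟨ ∨-distribʳ-∧ b d f ⟩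
      (d ∨ b) ∧ (f ∨ b)  ≡⟨ ∧-comm (d ∨ b) (f ∨ b) ⟩
      (f ∨ b) ∧ (d ∨ b)  ∎)
    where open ≡-Reasoning

  K-kleene : ∀ x y → (x ∧ᴷ (∼ᴷ x)) ≈ᴷ ((x ∧ᴷ (∼ᴷ x)) ∧ᴷ (y ∨ᴷ (∼ᴷ y)))
  K-kleene ((a , b) , a∧b≡𝟘) ((c , d) , c∧d≡𝟘) = cong₂ _,_
    (subst (_≤ (c ∨ d)) (sym a∧b≡𝟘) (𝟘-min (c ∨ d)))
    (sym (trans (cong ((b ∨ a) ∨_) (trans (∧-comm d c) c∧d≡𝟘)) (∨-identityʳ (b ∨ a))))

  module _ (residuated : Residuated) where

    K-∧-⇒N : ∀ x y → (x ∧ᴷ (x ⇒Nᴷ y)) ≈ᴷ (x ∧ᴷ ((∼ᴷ x) ∨ᴷ y))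
    K-∧-⇒N ((a , b) , a∧b≡𝟘) ((c , d) , _) = cong₂ _,_
      (trans (∧-⇒N residuated a c) (sym (∧-disjoint-∨ c a∧b≡𝟘)))
      (cong (b ∨_) (∧-disjoint-∨ d a∧b≡𝟘))

    K-⇒N-curry : ∀ x y z → (x ⇒Nᴷ (y ⇒Nᴷ z)) ≈ᴷ ((x ∧ᴷ y) ⇒Nᴷ z)
    K-⇒N-curry ((a , b) , a∧b≡𝟘) ((c , d) , c∧d≡𝟘) ((e , f) , _) = cong₂ _,_
      (⇒N-curry residuated a c e)
      (begin
        a ∧ (b ∨ (c ∧ (d ∨ f)))  ≡⟨ ∧-disjoint-∨ (c ∧ (d ∨ f)) a∧b≡𝟘 ⟩
        a ∧ (c ∧ (d ∨ f))        ≡⟨ cong (a ∧_) (∧-disjoint-∨ f c∧d≡𝟘) ⟩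
        a ∧ (c ∧ f)              ≡⟨ ∧-assoc a c f ⟨
        (a ∧ c) ∧ f              ≡⟨ ∧-disjoint-∨ f (meet-closed a b c d a∧b≡𝟘 c∧d≡𝟘) ⟨
        (a ∧ c) ∧ ((b ∨ d) ∨ f)  ∎)
      where open ≡-Reasoning

  semiHeyting⇒semiNelson : IsSemiHeyting A → IsSemiNelson (K A)
  semiHeyting⇒semiNelson semiHeyting = record
    { SN1  = K-∧-absorbs-∨
    ; SN2  = K-∧-distrib-∨
    ; SN3  = λ _ → refl
    ; SN4  = λ _ _ → refl
    ; SN5  = K-kleene
    ; SN6  = K-∧-⇒N residuated
    ; SN7  = K-⇒N-curry residuated
    ; SN8  = λ x y z → ⇒Nᴷ≈𝟙ᴷ (x ⇒Nᴷ y) ((y ⇒Nᴷ x) ⇒Nᴷ ((x ⇒ᴷ z) ⇒Nᴷ (y ⇒ᴷ z)))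
               (compatible⇒⇒N-≤ residuated (compatibleˡ (fst z)) (fst x) (fst y))
    ; SN9  = λ x y z → ⇒Nᴷ≈𝟙ᴷ (x ⇒Nᴷ y) ((y ⇒Nᴷ x) ⇒Nᴷ ((z ⇒ᴷ x) ⇒Nᴷ (z ⇒ᴷ y)))
               (compatible⇒⇒N-≤ residuated (compatibleʳ (fst z)) (fst x) (fst y))
    ; SN10 = λ x y → ⇒Nᴷ≈𝟙ᴷ (∼ᴷ (x ⇒ᴷ y)) (x ∧ᴷ (∼ᴷ y)) ≤-refl
    ; SN11 = λ x y → ⇒Nᴷ≈𝟙ᴷ (x ∧ᴷ (∼ᴷ y)) (∼ᴷ (x ⇒ᴷ y)) ≤-refl
    }
    where
    compatibleˡ : ∀ e → Compatible (_⇒ e)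
    compatibleˡ = semiHeyting⇒compatibleˡ semiHeyting

    compatibleʳ : ∀ e → Compatible (e ⇒_)
    compatibleʳ = semiHeyting⇒compatibleʳ semiHeyting

    residuated : Residuated
    residuated = compatibleʳ⇒residuated compatibleʳ

  embed : Carrier → KCarrier
  embed a = (a , 𝟘) , ∧𝟘 a

  semiNelson⇒semiHeyting : IsSemiNelson (K A) → IsSemiHeyting A
  semiNelson⇒semiHeyting semiNelson = compatible⇒semiHeyting
    (λ e → ⇒N-≤⇒compatible residuated λ a c →
      ⇒N≡𝟙⇒≤ (cong proj₁ (SN8 (embed a) (embed c) (embed e))))
    (λ e → ⇒N-≤⇒compatible residuated λ a c →
      ⇒N≡𝟙⇒≤ (cong proj₁ (SN9 (embed a) (embed c) (embed e))))
    where
    open IsSemiNelson semiNelson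
    residuated : Residuated
    residuated = currying⇒residuated λ a b c → cong proj₁ (SN7 (embed a) (embed b) (embed c))

proposition42 : ∀ {ℓ : Level} (A : HLattice ℓ) → IsSemiHeyting A ⇔ IsSemiNelson (K A)
proposition42 A = mk⇔ semiHeyting⇒semiNelson semiNelson⇒semiHeyting
  where open KProperties A
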